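{- For every $0\le i<t$ and all $u,v\in V(G)$, \[ \Pr(\phi^i\in\Gamma_i(v,u))-\Pr(\phi^i\in\Gamma_i(u,v))=\Pr(\phi^i\in\Gamma_i^{nc}(v,u))-\Pr(\phi^i\in\Gamma_i^{nc}(u,v)). \]
   Context: Let $T$ be a tree with $t+1$ vertices ($t\ge1$). Fix an ordering $x_0,\dots,x_t$ of $V(T)$ obtained by breadth-first search started at a leaf $x_0$; root $T$ at $x_0$ and for $1\le j\le t$ let $a(j)$ be the index such that $x_{a(j)}$ is the parent of $x_j$. Let $T^i$ be the subtree induced on $\{x_0,\dots,x_i\}$. Let $G$ be a finite simple graph with $n$ vertices, edge set $E$, average degree $d=2|E|/n$ and minimum degree $\delta(G)\ge d/4$ (with $\delta(G)>t$); $d(v)$, $N(v)$ denote degree and neighbourhood. $\mathrm{Mon}(T^i,G)$ is the set of injective homomorphisms $T^i\to G$; for $\gamma$ in it write $\gamma_j=\gamma(x_j)$. The random embedding $\phi=(\phi_0,\dots,\phi_t)$: $\Pr(\phi_0=v)=d(v)/(2|E|)$, and for $1\le j\le t$, given $\phi_0,\dots,\phi_{j-1}$, $\phi_j$ is uniform on $N(\phi_{a(j)})\setminus\{\phi_0,\dots,\phi_{j-1}\}$; $\phi^i=(\phi_0,\dots,\phi_i)$. $\Gamma_i(u,v)=\{\gamma\in\mathrm{Mon}(T^i,G):\gamma_0=u,\ \gamma_{a(i+1)}=v\}$. An element $\gamma\in\mathrm{Mon}(T^i,G)$ is complete if $\{\gamma_0,\gamma_j\}\in E$ and $\{\gamma_{a(i+1)},\gamma_j\}\in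 E$ for every $0<j<a(i+1)$ such that $x_j$ is not a leaf of $T^{a(i+1)}$; otherwise it is non-complete. $\Gamma_i^{nc}(u,v)$ is the set of non-complete elements of $\Gamma_i(u,v)$. -}

module Defs where

open import Data.Nat as ℕ using (ℕ; zero; suc; _<_; _≤_; _≡ᵇ_; _<ᵇ_; _∸_)
open import Data.Fin as Fin using (Fin)
open import Data.List using (List; []; _∷_; [_]; _++_; length; map; filterᵇ; upTo; allFin; foldr)
open import Data.Bool.ListAction using (any; all)
open import Data.Bool using (Bool; true; false; not; _∧_; _∨_; if_then_else_)
open import Data.Maybe using (Maybe; just; nothing)
open import Data.Integer using (+_)
open import Data.Rational as ℚ using (ℚ; 0ℚ; 1ℚ; _/_)
open import Relation.Nullary using (does)
open import Relation.Binary.PropositionalEquality using (_≡_)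

record SimpleGraph (n : ℕ) : Set where
  field
    adj    : Fin n → Fin n → Bool
    sym    : ∀ u v → adj u v ≡ adj v u
    irrefl : ∀ v → adj v v ≡ false
open SimpleGraph public

neighbours : ∀ {n} → SimpleGraph n → Fin n → List (Fin n)
neighbours {n} G v = filterᵇ (adj G v) (allFin n)

deg : ∀ {n} → SimpleGraph n → Fin n → ℕ
deg G v = length (neighbours G v)

sumℕ : List ℕ → ℕ
sumℕ = foldr ℕ._+_ 0

twiceEdges : ∀ {n} → SimpleGraph n → ℕ
twiceEdges {n} G = sumℕ (map (deg G) (allFin n))

-- A tree on x_0,…,x_t given by a BFS ordering from the leaf x_0:
-- parent j = a(j) is the index of the parent of x_j (1 ≤ j ≤ t).
-- BFS orderings are exactly those with a(j) < j and a nondecreasing;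
-- x_0 is a leaf iff x_1 is its only child.

record BFSTree (t : ℕ) : Set where
  field
    parent      : ℕ → ℕ
    parent-<    : ∀ j → 1 ≤ j → j ≤ t → parent j < j
    parent-mono : ∀ j → 1 ≤ j → j < t → parent j ≤ parent (suc j)
    root-leaf   : ∀ j → 2 ≤ j → j ≤ t → 1 ≤ parent j
open BFSTree public

nth : ∀ {A : Set} → List A → ℕ → Maybe A
nth []       _       = nothing
nth (x ∷ xs) zero    = just x
nth (x ∷ xs) (suc k) = nth xs k

elemᵇ : ∀ {n} → Fin n → List (Fin n) → Bool
elemᵇ x xs = any (λ y → does (x Fin.≟ y)) xs

distinct : ∀ {n} → List (Fin n) → Bool
distinct []       = true
distinct (x ∷ xs) = not (elemᵇ x xs) ∧ distinct xs

range1 : ℕ → List ℕ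
range1 m = map suc (upTo m)

sumℚ : List ℚ → ℚ
sumℚ = foldr ℚ._+_ 0ℚ

fromℕ : ℕ → ℚ
fromℕ k = (+ k) / 1

-- 1/k (with the convention 1/0 = 0; never used under the hypotheses)
inv : ℕ → ℚ
inv zero    = 0ℚ
inv (suc k) = (+ 1) / suc k

-- Embeddings γ are lists γ_0,…,γ_i of vertices.

module _ {n : ℕ} (G : SimpleGraph n) {t : ℕ} (T : BFSTree t) where

  private
    a = parent T

  eqAt : List (Fin n) → ℕ → Fin n → Bool
  eqAt γ p w with nth γ p
  ... | just x  = does (x Fin.≟ w)
  ... | nothing = false

  adjAt : List (Fin n) → ℕ → ℕ → Bool
  adjAt γ p q with nth γ p | nth γ q
  ... | just x | just y = adj G x y
  ... | _      | _      = false

  isMon : ℕ → List (Fin n) → Bool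
  isMon i γ = (length γ ≡ᵇ suc i) ∧ distinct γ ∧ all (λ j → adjAt γ (a j) j) (range1 i)

  isΓ : ℕ → Fin n → Fin n → List (Fin n) → Bool
  isΓ i u v γ = isMon i γ ∧ eqAt γ 0 u ∧ eqAt γ (a (suc i)) v

  isLeafIn : ℕ → ℕ → Bool
  isLeafIn m j = all (λ k → not ((j <ᵇ k) ∧ (a k ≡ᵇ j))) (range1 m)

  isComplete : ℕ → List (Fin n) → Bool
  isComplete i γ =
    all (λ j → isLeafIn m j ∨ (adjAt γ 0 j ∧ adjAt γ m j)) (range1 (m ∸ 1))
    where m = a (suc i)

  isΓnc : ℕ → Fin n → Fin n → List (Fin n) → Bool
  isΓnc i u v γ = isΓ i u v γ ∧ not (isComplete i γ)

  candidates : List (Fin n) → List (Fin n)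
  candidates pre with nth pre (a (length pre))
  ... | just w  = filterᵇ (λ y → not (elemᵇ y pre)) (neighbours G w)
  ... | nothing = []

  -- probability that, starting from the prefix pre and performing r more
  -- steps of the process, the resulting sequence satisfies P
  extend : (List (Fin n) → Bool) → ℕ → List (Fin n) → ℚ
  extend P zero    pre = if P pre then 1ℚ else 0ℚ
  extend P (suc r) pre =
    inv (length C) ℚ.* sumℚ (map (λ w → extend P r (pre ++ [ w ])) C)
    where C = candidates pre

  Pr : ℕ → (List (Fin n) → Bool) → ℚ
  Pr i P = sumℚ (map (λ v → (fromℕ (deg G v) ℚ.* inv (twiceEdges G)) ℚ.* extend P i [ v ]) (allFin n))

-- Split Γ_i(u,v) into its complete and non-complete parts: it suffices that the complete parts of
-- Γ_i(u,v) and Γ_i(v,u) are equally likely. Let m = a(i+1). Whether φ^i is a complete element of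
-- Γ_i(u,v) only depends on φ^m, and φ^m is distributed as the process stopped after m steps, so one
-- compares sequences x, γ_1, …, γ_{m-1}, y. Exchanging the endpoints x and y maps the complete
-- elements of Γ(u,v) onto those of Γ(v,u) and preserves probabilities: the first edge of φ is uniform
-- among the 2|E| oriented edges, and for every later step j ≤ m the parent x_{a(j)} is not a leaf of
-- T^m, so in a complete embedding its image c is adjacent to both x and y, and the number of
-- candidates |N(c) ∖ {φ_0, …, φ_{j-1}}| is unchanged by the exchange.

module Submission where

open import Defs
open import Data.Nat using (ℕ; _≤_; _<_; _*_)
open import Data.Fin using (Fin)
open import Data.Rational using (_-_)
open import Relation.Binary.PropositionalEquality using (_≡_)

open import Data.Nat using (zero; suc; z≤n; s≤s; _∸_; _≡ᵇ_; _<ᵇ_)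
import Data.Nat as ℕ
import Data.Nat.Properties as ℕP
import Data.Fin as Fin
open import Data.Integer as ℤ using (ℤ; +_)
open import Data.Integer.Tactic.RingSolver using (solve-∀)
open import Data.Rational as ℚ using (ℚ; 0ℚ; 1ℚ)
import Data.Rational.Properties as ℚP
import Data.Rational.Unnormalised as ℚᵘ
import Data.Rational.Unnormalised.Properties as ℚᵘP
open import Data.Rational.Solver using (module +-*-Solver)
open import Data.Bool using (Bool; true; false; not; _∧_; _∨_; if_then_else_; T; T?)
import Data.Bool.Properties as BP
open import Data.Bool.ListAction using (all)
open import Data.List using (List; []; _∷_; [_]; _++_; length; map; filterᵇ; allFin)
import Data.List.Properties as LP
open import Data.List.Membership.Propositional using (_∈_; _∉_)
import Data.List.Membership.Propositional.Properties as MP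
open import Data.List.Relation.Unary.Any using (here; there)
open import Data.List.Relation.Unary.All.Properties using (All¬⇒¬Any)
open import Data.List.Relation.Unary.AllPairs using (_∷_)
open import Data.List.Relation.Unary.Unique.Propositional using (Unique)
import Data.List.Relation.Unary.Unique.Propositional.Properties as UniqueP
open import Data.Maybe using (Maybe; just; nothing)
open import Data.Product using (Σ-syntax; _×_; _,_; proj₁; proj₂; swap)
open import Data.Sum using (inj₁; inj₂)
open import Data.Empty using (⊥-elim)
open import Function using (_∘_)
open import Algebra.Bundles using (CommutativeMonoid)
open import Algebra.Properties.CommutativeSemigroup (CommutativeMonoid.commutativeSemigroup BP.∧-commutativeMonoid)
  using (x∙yz≈y∙xz)
open import Relation.Nullary using (yes; no; does)
open import Relation.Nullary.Decidable using (dec-true; dec-false)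
open import Relation.Binary.PropositionalEquality
  using (_≢_; refl; trans; cong; cong₂; subst; subst₂; module ≡-Reasoning)
import Relation.Binary.PropositionalEquality as ≡

-- _/_ normalises through a gcd that does not reduce on a variable, so these identities are
-- checked on unnormalised representatives.
fromℕ-suc : ∀ k → fromℕ (suc k) ≡ 1ℚ ℚ.+ fromℕ k
fromℕ-suc k = ℚP.toℚᵘ-injective (ℚᵘP.≃-trans (ℚP.toℚᵘ-fromℚᵘ (ℚᵘ.mkℚᵘ (+ suc k) 0))
  (ℚᵘP.≃-sym (ℚᵘP.≃-trans (ℚP.toℚᵘ-homo-+ 1ℚ (fromℕ k))
    (ℚᵘP.≃-trans (ℚᵘP.+-cong (ℚP.toℚᵘ-fromℚᵘ (ℚᵘ.mkℚᵘ (+ 1) 0)) (ℚP.toℚᵘ-fromℚᵘ (ℚᵘ.mkℚᵘ (+ k) 0)))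
      (ℚᵘ.*≡* (identity (+ k)))))))
  where
  identity : ∀ (a : ℤ) → (+ 1 ℤ.* + 1 ℤ.+ a ℤ.* + 1) ℤ.* + 1 ≡ (+ 1 ℤ.+ a) ℤ.* (+ 1 ℤ.* + 1)
  identity = solve-∀

fromℕ*inv≡1 : ∀ {d} → 1 ≤ d → fromℕ d ℚ.* inv d ≡ 1ℚ
fromℕ*inv≡1 {suc k} _ = ℚP.toℚᵘ-injective (ℚᵘP.≃-trans (ℚP.toℚᵘ-homo-* (fromℕ (suc k)) (inv (suc k)))
  (ℚᵘP.≃-trans (ℚᵘP.*-cong (ℚP.toℚᵘ-fromℚᵘ (ℚᵘ.mkℚᵘ (+ suc k) 0)) (ℚP.toℚᵘ-fromℚᵘ (ℚᵘ.mkℚᵘ (+ 1) k)))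
    (ℚᵘ.*≡* (identity (+ suc k)))))
  where
  identity : ∀ (a : ℤ) → (a ℤ.* + 1) ℤ.* + 1 ≡ + 1 ℤ.* (+ 1 ℤ.* a)
  identity = solve-∀

fromℕ*-*inv : ∀ {d} q → 1 ≤ d → (fromℕ d ℚ.* q) ℚ.* inv d ≡ q
fromℕ*-*inv {d} q 1≤d = begin
  (fromℕ d ℚ.* q) ℚ.* inv d ≡⟨ ℚP.*-assoc (fromℕ d) q (inv d) ⟩
  fromℕ d ℚ.* (q ℚ.* inv d) ≡⟨ cong (fromℕ d ℚ.*_) (ℚP.*-comm q (inv d)) ⟩
  fromℕ d ℚ.* (inv d ℚ.* q) ≡⟨ ℚP.*-assoc (fromℕ d) (inv d) q ⟨
  (fromℕ d ℚ.* inv d) ℚ.* q ≡⟨ cong (ℚ._* q) (fromℕ*inv≡1 1≤d) ⟩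
  1ℚ ℚ.* q                  ≡⟨ ℚP.*-identityˡ q ⟩
  q                         ∎
  where open ≡-Reasoning

𝟙 : Bool → ℚ
𝟙 b = if b then 1ℚ else 0ℚ

𝟙-split : ∀ b c → 𝟙 b ≡ 𝟙 (b ∧ c) ℚ.+ 𝟙 (b ∧ not c)
𝟙-split true  true  = ≡.sym (ℚP.+-identityʳ 1ℚ)
𝟙-split true  false = ≡.sym (ℚP.+-identityˡ 1ℚ)
𝟙-split false c     = ≡.sym (ℚP.+-identityˡ 0ℚ)

if-≢0 : ∀ b (p : ℚ) → (if b then p else 0ℚ) ≢ 0ℚ → b ≡ true
if-≢0 true  p _   = refl
if-≢0 false p ≢0 = ⊥-elim (≢0 refl)

if-true : ∀ {b} (p : ℚ) → b ≡ true → (if b then p else 0ℚ) ≡ p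
if-true p refl = refl

if-* : ∀ b (p q : ℚ) → (if b then p else 0ℚ) ℚ.* q ≡ (if b then p ℚ.* q else 0ℚ)
if-* true  p q = refl
if-* false p q = ℚP.*-zeroˡ q

*-cong-≢0ˡ : ∀ p {q q′} → (p ≢ 0ℚ → q ≡ q′) → p ℚ.* q ≡ p ℚ.* q′
*-cong-≢0ˡ p {q} {q′} h with p ℚ.≟ 0ℚ
... | yes refl = trans (ℚP.*-zeroˡ q) (≡.sym (ℚP.*-zeroˡ q′))
... | no p≢0    = cong (p ℚ.*_) (h p≢0)

*𝟙-cong : ∀ {p q} b → (b ≡ true → p ≡ q) → p ℚ.* 𝟙 b ≡ q ℚ.* 𝟙 b
*𝟙-cong         true  p≡q = cong (ℚ._* 1ℚ) (p≡q refl)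
*𝟙-cong {p} {q} false _   = trans (ℚP.*-zeroʳ p) (≡.sym (ℚP.*-zeroʳ q))

*-≢0ˡ : ∀ (p q : ℚ) → p ℚ.* q ≢ 0ℚ → p ≢ 0ℚ
*-≢0ˡ p q ≢0 refl = ≢0 (ℚP.*-zeroˡ q)

*-≢0ʳ : ∀ (p q : ℚ) → p ℚ.* q ≢ 0ℚ → q ≢ 0ℚ
*-≢0ʳ p q ≢0 refl = ≢0 (ℚP.*-zeroʳ p)

[k+p]-[k+q]≡p-q : ∀ (k p q : ℚ) → (k ℚ.+ p) - (k ℚ.+ q) ≡ p - q
[k+p]-[k+q]≡p-q = solve 3 (λ k p q → (k :+ p) :- (k :+ q) := p :- q) refl
  where open +-*-Solver

module _ {A : Set} where

  sumℚ-cong : ∀ {f g : A → ℚ} xs → (∀ x → f x ≡ g x) → sumℚ (map f xs) ≡ sumℚ (map g xs)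
  sumℚ-cong []       f≗g = refl
  sumℚ-cong (x ∷ xs) f≗g = cong₂ ℚ._+_ (f≗g x) (sumℚ-cong xs f≗g)

  sumℚ-0 : ∀ (xs : List A) → sumℚ (map (λ _ → 0ℚ) xs) ≡ 0ℚ
  sumℚ-0 []       = refl
  sumℚ-0 (x ∷ xs) = trans (ℚP.+-identityˡ _) (sumℚ-0 xs)

  sumℚ-+ : ∀ (f g : A → ℚ) xs →
           sumℚ (map (λ x → f x ℚ.+ g x) xs) ≡ sumℚ (map f xs) ℚ.+ sumℚ (map g xs)
  sumℚ-+ f g []       = refl
  sumℚ-+ f g (x ∷ xs) =
    trans (cong (f x ℚ.+ g x ℚ.+_) (sumℚ-+ f g xs)) (interchange (f x) (g x) _ _)
    where
    open +-*-Solver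
    interchange : ∀ (a b c d : ℚ) → (a ℚ.+ b) ℚ.+ (c ℚ.+ d) ≡ (a ℚ.+ c) ℚ.+ (b ℚ.+ d)
    interchange = solve 4 (λ a b c d → (a :+ b) :+ (c :+ d) := (a :+ c) :+ (b :+ d)) refl

  *-sumℚ : ∀ c (f : A → ℚ) xs → c ℚ.* sumℚ (map f xs) ≡ sumℚ (map (λ x → c ℚ.* f x) xs)
  *-sumℚ c f []       = ℚP.*-zeroʳ c
  *-sumℚ c f (x ∷ xs) = trans (ℚP.*-distribˡ-+ c (f x) _) (cong (c ℚ.* f x ℚ.+_) (*-sumℚ c f xs))

  sumℚ-filterᵇ : ∀ (p : A → Bool) (f : A → ℚ) xs →
                 sumℚ (map f (filterᵇ p xs)) ≡ sumℚ (map (λ x → if p x then f x else 0ℚ) xs)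
  sumℚ-filterᵇ p f []       = refl
  sumℚ-filterᵇ p f (x ∷ xs) with p x
  ... | true  = cong (f x ℚ.+_) (sumℚ-filterᵇ p f xs)
  ... | false = trans (sumℚ-filterᵇ p f xs) (≡.sym (ℚP.+-identityˡ _))

  sumℚ-if-const : ∀ (p : A → Bool) c xs →
                  sumℚ (map (λ x → if p x then c else 0ℚ) xs) ≡ fromℕ (length (filterᵇ p xs)) ℚ.* c
  sumℚ-if-const p c []       = ≡.sym (ℚP.*-zeroˡ c)
  sumℚ-if-const p c (x ∷ xs) with p x
  ... | false = trans (ℚP.+-identityˡ _) (sumℚ-if-const p c xs)
  ... | true  = begin
    c ℚ.+ sumℚ (map (λ x → if p x then c else 0ℚ) xs) ≡⟨ cong (c ℚ.+_) (sumℚ-if-const p c xs) ⟩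
    c ℚ.+ fromℕ ℓ ℚ.* c          ≡⟨ cong (ℚ._+ fromℕ ℓ ℚ.* c) (ℚP.*-identityˡ c) ⟨
    1ℚ ℚ.* c ℚ.+ fromℕ ℓ ℚ.* c   ≡⟨ ℚP.*-distribʳ-+ c 1ℚ (fromℕ ℓ) ⟨
    (1ℚ ℚ.+ fromℕ ℓ) ℚ.* c       ≡⟨ cong (ℚ._* c) (fromℕ-suc ℓ) ⟨
    fromℕ (suc ℓ) ℚ.* c          ∎
    where
    open ≡-Reasoning
    ℓ = length (filterᵇ p xs)

sumℚ-comm : ∀ {A B : Set} (f : A → B → ℚ) xs ys →
            sumℚ (map (λ x → sumℚ (map (f x) ys)) xs) ≡ sumℚ (map (λ y → sumℚ (map (λ x → f x y) xs)) ys)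
sumℚ-comm f []       ys = ≡.sym (sumℚ-0 ys)
sumℚ-comm f (x ∷ xs) ys = trans (cong (sumℚ (map (f x) ys) ℚ.+_) (sumℚ-comm f xs ys))
                                (≡.sym (sumℚ-+ (f x) (λ y → sumℚ (map (λ x′ → f x′ y) xs)) ys))

module _ {A : Set} where

  nth-++ˡ : ∀ (xs ys : List A) {p} → p < length xs → nth (xs ++ ys) p ≡ nth xs p
  nth-++ˡ (x ∷ xs) ys {zero}  _         = refl
  nth-++ˡ (x ∷ xs) ys {suc p} (s≤s p<∣xs∣) = nth-++ˡ xs ys p<∣xs∣

  nth-++-length : ∀ (xs : List A) y ys → nth (xs ++ y ∷ ys) (length xs) ≡ just y
  nth-++-length []       y ys = refl
  nth-++-length (x ∷ xs) y ys = nth-++-length xs y ys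

  nth-∷ : ∀ (x : A) xs {p} → 1 ≤ p → nth (x ∷ xs) p ≡ nth xs (p ∸ 1)
  nth-∷ x xs {suc p} _ = refl

  nth-defined : ∀ (xs : List A) {p} → p < length xs → Σ[ x ∈ A ] nth xs p ≡ just x
  nth-defined (x ∷ xs) {zero}  _         = x , refl
  nth-defined (x ∷ xs) {suc p} (s≤s p<∣xs∣) = nth-defined xs p<∣xs∣

  all-true⁻ : ∀ (f : A → Bool) xs {x} → all f xs ≡ true → x ∈ xs → f x ≡ true
  all-true⁻ f (y ∷ xs) eq (here refl) = BP.∧-conicalˡ (f y) _ eq
  all-true⁻ f (y ∷ xs) eq (there x∈xs) = all-true⁻ f xs (BP.∧-conicalʳ (f y) _ eq) x∈xs

  all-true⁺ : ∀ (f : A → Bool) xs → (∀ x → x ∈ xs → f x ≡ true) → all f xs ≡ true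
  all-true⁺ f []       _ = refl
  all-true⁺ f (y ∷ xs) h = cong₂ _∧_ (h y (here refl)) (all-true⁺ f xs (λ x → h x ∘ there))

  all-cong : ∀ (f g : A → Bool) xs → (∀ x → x ∈ xs → f x ≡ g x) → all f xs ≡ all g xs
  all-cong f g []       _ = refl
  all-cong f g (y ∷ xs) h = cong₂ _∧_ (h y (here refl)) (all-cong f g xs (λ x → h x ∘ there))

  length-∷ʳ : ∀ (xs : List A) x → length (xs ++ [ x ]) ≡ suc (length xs)
  length-∷ʳ xs x = trans (LP.length-++ xs) (ℕP.+-comm (length xs) 1)

  filterᵇ-filterᵇ : ∀ (p q : A → Bool) xs → filterᵇ p (filterᵇ q xs) ≡ filterᵇ (λ x → q x ∧ p x) xs
  filterᵇ-filterᵇ p q []       = refl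
  filterᵇ-filterᵇ p q (x ∷ xs) with q x
  ... | false = filterᵇ-filterᵇ p q xs
  ... | true with p x
  ...   | true  = cong (x ∷_) (filterᵇ-filterᵇ p q xs)
  ...   | false = filterᵇ-filterᵇ p q xs

  filterᵇ-true : ∀ (xs : List A) → filterᵇ (λ _ → true) xs ≡ xs
  filterᵇ-true []       = refl
  filterᵇ-true (x ∷ xs) = cong (x ∷_) (filterᵇ-true xs)

  filterᵇ-false : ∀ (xs : List A) → filterᵇ (λ _ → false) xs ≡ []
  filterᵇ-false []       = refl
  filterᵇ-false (x ∷ xs) = filterᵇ-false xs

∈-range1 : ∀ {j k} → j ∈ range1 k → 1 ≤ j × j ≤ k
∈-range1 j∈ with _ , i∈ , refl ← MP.∈-map⁻ suc j∈ = s≤s z≤n , MP.∈-upTo⁻ i∈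

∈-range1⁺ : ∀ {j k} → 1 ≤ j → j ≤ k → j ∈ range1 k
∈-range1⁺ {suc j} _ j≤k = MP.∈-map⁺ suc (MP.∈-upTo⁺ j≤k)

all-range1⁻ : ∀ (f : ℕ → Bool) k → all f (range1 k) ≡ true → ∀ j → 1 ≤ j → j ≤ k → f j ≡ true
all-range1⁻ f k eq j 1≤j j≤k = all-true⁻ f (range1 k) eq (∈-range1⁺ 1≤j j≤k)

all-range1⁺ : ∀ (f : ℕ → Bool) k → (∀ j → 1 ≤ j → j ≤ k → f j ≡ true) → all f (range1 k) ≡ true
all-range1⁺ f k h = all-true⁺ f (range1 k) (λ j j∈ → h j (proj₁ (∈-range1 j∈)) (proj₂ (∈-range1 j∈)))

all-range1-cong : ∀ (f g : ℕ → Bool) k → (∀ j → 1 ≤ j → j ≤ k → f j ≡ g j) →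
                  all f (range1 k) ≡ all g (range1 k)
all-range1-cong f g k h = all-cong f g (range1 k) (λ j j∈ → h j (proj₁ (∈-range1 j∈)) (proj₂ (∈-range1 j∈)))

true≢false : true ≢ false
true≢false ()

T⇒≡true : ∀ {b} → T b → b ≡ true
T⇒≡true {true} _ = refl

∧-not-true : ∀ {b c} → b ∧ not c ≡ true → b ≡ true × c ≡ false
∧-not-true {true} {false} _ = refl , refl

module _ {n : ℕ} where

  does-false⇒≢ : ∀ {x y : Fin n} → does (x Fin.≟ y) ≡ false → x ≢ y
  does-false⇒≢ {x} {y} eq x≡y = true≢false (trans (≡.sym (dec-true (x Fin.≟ y) x≡y)) eq)

  elemᵇ-++ : ∀ (x : Fin n) xs ys → elemᵇ x (xs ++ ys) ≡ elemᵇ x xs ∨ elemᵇ x ys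
  elemᵇ-++ x []       ys = refl
  elemᵇ-++ x (y ∷ xs) ys rewrite elemᵇ-++ x xs ys = ≡.sym (BP.∨-assoc (does (x Fin.≟ y)) _ _)

  ∉ᵇ-∷⁻ : ∀ (x y : Fin n) ys → elemᵇ x (y ∷ ys) ≡ false → x ≢ y × elemᵇ x ys ≡ false
  ∉ᵇ-∷⁻ x y ys x∉ =
    does-false⇒≢ (BP.∨-conicalˡ (does (x Fin.≟ y)) _ x∉) , BP.∨-conicalʳ (does (x Fin.≟ y)) _ x∉

  ∉ᵇ-∷⁺ : ∀ (x y : Fin n) ys → x ≢ y → elemᵇ x ys ≡ false → elemᵇ x (y ∷ ys) ≡ false
  ∉ᵇ-∷⁺ x y ys x≢y x∉ys = cong₂ _∨_ (dec-false (x Fin.≟ y) x≢y) x∉ys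

  ∉ᵇ-++⁻ : ∀ (x : Fin n) xs ys → elemᵇ x (xs ++ ys) ≡ false → elemᵇ x xs ≡ false × elemᵇ x ys ≡ false
  ∉ᵇ-++⁻ x xs ys x∉ = let x∉′ = trans (≡.sym (elemᵇ-++ x xs ys)) x∉ in
    BP.∨-conicalˡ (elemᵇ x xs) _ x∉′ , BP.∨-conicalʳ (elemᵇ x xs) _ x∉′

  ∉ᵇ-++⁺ : ∀ (x : Fin n) xs ys → elemᵇ x xs ≡ false → elemᵇ x ys ≡ false → elemᵇ x (xs ++ ys) ≡ false
  ∉ᵇ-++⁺ x xs ys x∉xs x∉ys = trans (elemᵇ-++ x xs ys) (cong₂ _∨_ x∉xs x∉ys)

  distinct-∷ʳ : ∀ (xs : List (Fin n)) y → distinct xs ≡ true → elemᵇ y xs ≡ false →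
                distinct (xs ++ [ y ]) ≡ true
  distinct-∷ʳ []       y _  _ = refl
  distinct-∷ʳ (x ∷ xs) y dx y∉x∷xs with y≢x , y∉xs ← ∉ᵇ-∷⁻ y x xs y∉x∷xs =
    cong₂ _∧_ (cong not (∉ᵇ-++⁺ x xs [ y ] x∉xs (∉ᵇ-∷⁺ x y [] (y≢x ∘ ≡.sym) refl)))
              (distinct-∷ʳ xs y (BP.∧-conicalʳ (not (elemᵇ x xs)) _ dx) y∉xs)
    where x∉xs = BP.not-injective (BP.∧-conicalˡ (not (elemᵇ x xs)) _ dx)

  _∖_ : List (Fin n) → List (Fin n) → List (Fin n)
  xs ∖ ys = filterᵇ (λ z → not (elemᵇ z ys)) xs

  length-∖-∷-∉ : ∀ {x} ys xs → x ∉ xs → length (xs ∖ (x ∷ ys)) ≡ length (xs ∖ ys)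
  length-∖-∷-∉         ys []       _   = refl
  length-∖-∷-∉ {x} ys (z ∷ xs) x∉ with z Fin.≟ x
  ... | yes refl = ⊥-elim (x∉ (here refl))
  ... | no _ with elemᵇ z ys
  ...   | true  = length-∖-∷-∉ ys xs (x∉ ∘ there)
  ...   | false = cong suc (length-∖-∷-∉ ys xs (x∉ ∘ there))

  length-∖-∷ : ∀ {x} ys xs → Unique xs → length (xs ∖ ys) ≤ suc (length (xs ∖ (x ∷ ys)))
  length-∖-∷         ys []       _ = z≤n
  length-∖-∷ {x} ys (z ∷ xs) (z∉xs ∷ uxs) with z Fin.≟ x
  ... | yes refl with elemᵇ z ys
  ...   | true  = ℕP.m≤n⇒m≤1+n (ℕP.≤-reflexive (≡.sym (length-∖-∷-∉ ys xs (All¬⇒¬Any z∉xs))))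
  ...   | false = s≤s (ℕP.≤-reflexive (≡.sym (length-∖-∷-∉ ys xs (All¬⇒¬Any z∉xs))))
  length-∖-∷ {x} ys (z ∷ xs) (_ ∷ uxs) | no _ with elemᵇ z ys
  ...   | true  = length-∖-∷ ys xs uxs
  ...   | false = s≤s (length-∖-∷ ys xs uxs)

  length-∖-∷-∈ : ∀ {x} ys xs → Unique xs → x ∈ xs → elemᵇ x ys ≡ false →
                 length (xs ∖ ys) ≡ suc (length (xs ∖ (x ∷ ys)))
  length-∖-∷-∈ {x} ys (z ∷ xs) (z∉xs ∷ uxs) x∈ x∉ys with z Fin.≟ x
  ... | yes refl rewrite x∉ys = cong suc (≡.sym (length-∖-∷-∉ ys xs (All¬⇒¬Any z∉xs)))
  length-∖-∷-∈ ys (z ∷ xs) _ (here refl) _ | no z≢x = ⊥-elim (z≢x refl)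
  length-∖-∷-∈ ys (z ∷ xs) (_ ∷ uxs) (there x∈) x∉ys | no _ with elemᵇ z ys
  ... | true  = length-∖-∷-∈ ys xs uxs x∈ x∉ys
  ... | false = cong suc (length-∖-∷-∈ ys xs uxs x∈ x∉ys)

  length-∖-∷-swap : ∀ {x y} ys xs → Unique xs → x ∈ xs → y ∈ xs → elemᵇ x ys ≡ false → elemᵇ y ys ≡ false →
                    length (xs ∖ (x ∷ ys)) ≡ length (xs ∖ (y ∷ ys))
  length-∖-∷-swap ys xs uxs x∈ y∈ x∉ys y∉ys =
    ℕP.suc-injective (trans (≡.sym (length-∖-∷-∈ ys xs uxs x∈ x∉ys)) (length-∖-∷-∈ ys xs uxs y∈ y∉ys))

  length-∖ : ∀ ys xs → Unique xs → length xs ≤ length (xs ∖ ys) ℕ.+ length ys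
  length-∖ []       xs _   =
    ℕP.≤-reflexive (trans (cong length (≡.sym (filterᵇ-true xs))) (≡.sym (ℕP.+-identityʳ _)))
  length-∖ (y ∷ ys) xs uxs = begin
    length xs                                ≤⟨ length-∖ ys xs uxs ⟩
    length (xs ∖ ys) ℕ.+ length ys           ≤⟨ ℕP.+-monoˡ-≤ (length ys) (length-∖-∷ ys xs uxs) ⟩
    suc (length (xs ∖ (y ∷ ys))) ℕ.+ length ys ≡⟨ ℕP.+-suc _ (length ys) ⟨
    length (xs ∖ (y ∷ ys)) ℕ.+ length (y ∷ ys) ∎
    where open ℕP.≤-Reasoning

∸1<-≤ : ∀ {p l} → 1 ≤ p → p ≤ l → p ∸ 1 < l
∸1<-≤ {suc p} _ 1+p≤l = 1+p≤l

+-suc-≤ : ∀ {k r t} → k ℕ.+ suc r ≤ t → suc k ≤ t × suc k ℕ.+ r ≤ t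
+-suc-≤ {k} {r} {t} k+1+r≤t = ℕP.≤-trans (s≤s (ℕP.m≤m+n k r)) 1+k+r≤t , 1+k+r≤t
  where 1+k+r≤t = subst (_≤ t) (ℕP.+-suc k r) k+1+r≤t

module Sequences (n : ℕ) where

  Seq : Set
  Seq = List (Fin n)

  ∑ : (Fin n → ℚ) → ℚ
  ∑ f = sumℚ (map f (allFin n))

  sumSeq : ℕ → (Seq → ℚ) → ℚ
  sumSeq zero    F = F []
  sumSeq (suc k) F = ∑ (λ x → sumSeq k (λ xs → F (x ∷ xs)))

  sumSeq-cong : ∀ k {F H : Seq → ℚ} → (∀ xs → length xs ≡ k → F xs ≡ H xs) → sumSeq k F ≡ sumSeq k H
  sumSeq-cong zero    F≗H = F≗H [] refl
  sumSeq-cong (suc k) F≗H = sumℚ-cong (allFin n) (λ x → sumSeq-cong k (λ xs → F≗H (x ∷ xs) ∘ cong suc))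

  *-sumSeq : ∀ k c (F : Seq → ℚ) → c ℚ.* sumSeq k F ≡ sumSeq k (λ xs → c ℚ.* F xs)
  *-sumSeq zero    c F = refl
  *-sumSeq (suc k) c F = trans (*-sumℚ c _ (allFin n)) (sumℚ-cong (allFin n) (λ x → *-sumSeq k c _))

  sumSeq-+-length : ∀ k r (F : Seq → ℚ) → sumSeq (k ℕ.+ r) F ≡ sumSeq k (λ xs → sumSeq r (λ ys → F (xs ++ ys)))
  sumSeq-+-length zero    r F = refl
  sumSeq-+-length (suc k) r F = sumℚ-cong (allFin n) (λ x → sumSeq-+-length k r (λ xs → F (x ∷ xs)))

  sumSeq-suc-∷ʳ : ∀ k (F : Seq → ℚ) → sumSeq (suc k) F ≡ sumSeq k (λ xs → ∑ (λ y → F (xs ++ [ y ])))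
  sumSeq-suc-∷ʳ zero    F = refl
  sumSeq-suc-∷ʳ (suc k) F = sumℚ-cong (allFin n) (λ x → sumSeq-suc-∷ʳ k (λ xs → F (x ∷ xs)))

  ∑-sumSeq-comm : ∀ k (F : Fin n → Seq → ℚ) → ∑ (λ x → sumSeq k (F x)) ≡ sumSeq k (λ xs → ∑ (λ x → F x xs))
  ∑-sumSeq-comm zero    F = refl
  ∑-sumSeq-comm (suc k) F =
    trans (sumℚ-comm (λ x y → sumSeq k (λ xs → F x (y ∷ xs))) (allFin n) (allFin n))
          (sumℚ-cong (allFin n) (λ y → ∑-sumSeq-comm k (λ x xs → F x (y ∷ xs))))

module Process {n : ℕ} (G : SimpleGraph n) {t : ℕ} (T : BFSTree t) where
  open Sequences n

  a : ℕ → ℕ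
  a = parent T

  adjAt-just : ∀ γ p q {x y} → nth γ p ≡ just x → nth γ q ≡ just y → adjAt G T γ p q ≡ adj G x y
  adjAt-just γ p q _ _ with nth γ p | nth γ q
  adjAt-just γ p q refl refl | just x | just y = refl

  eqAt-just : ∀ γ p w {x} → nth γ p ≡ just x → eqAt G T γ p w ≡ does (x Fin.≟ w)
  eqAt-just γ p w _ with nth γ p
  eqAt-just γ p w refl | just x = refl

  adjAt-++ˡ : ∀ γ e {p q} → p < length γ → q < length γ → adjAt G T (γ ++ e) p q ≡ adjAt G T γ p q
  adjAt-++ˡ γ e {p} {q} p<∣γ∣ q<∣γ∣ with x , γp≡x ← nth-defined γ p<∣γ∣ | y , γq≡y ← nth-defined γ q<∣γ∣ =
    trans (adjAt-just (γ ++ e) p q (trans (nth-++ˡ γ e p<∣γ∣) γp≡x) (trans (nth-++ˡ γ e q<∣γ∣) γq≡y))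
          (≡.sym (adjAt-just γ p q γp≡x γq≡y))

  eqAt-++ˡ : ∀ γ e {p} w → p < length γ → eqAt G T (γ ++ e) p w ≡ eqAt G T γ p w
  eqAt-++ˡ γ e {p} w p<∣γ∣ with x , γp≡x ← nth-defined γ p<∣γ∣ =
    trans (eqAt-just (γ ++ e) p w (trans (nth-++ˡ γ e p<∣γ∣) γp≡x)) (≡.sym (eqAt-just γ p w γp≡x))

  adjacentFresh : Maybe (Fin n) → Seq → Fin n → Bool
  adjacentFresh (just c) pre w = adj G c w ∧ not (elemᵇ w pre)
  adjacentFresh nothing  pre w = false

  isCandidate : Seq → Fin n → Bool
  isCandidate pre = adjacentFresh (nth pre (a (length pre))) pre

  isCandidate⁻ : ∀ pre w → isCandidate pre w ≡ true →
                 Σ[ c ∈ Fin n ] nth pre (a (length pre)) ≡ just c × adj G c w ≡ true × elemᵇ w pre ≡ false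
  isCandidate⁻ pre w _ with nth pre (a (length pre))
  isCandidate⁻ pre w cand | just c with adj G c w in c~w | elemᵇ w pre
  isCandidate⁻ pre w refl | just c | true | false = c , refl , c~w , refl

  candidates-at : ∀ pre {c} → nth pre (a (length pre)) ≡ just c → candidates G T pre ≡ neighbours G c ∖ pre
  candidates-at pre _ with nth pre (a (length pre))
  candidates-at pre refl | just c = refl

  candidates≡filterᵇ : ∀ pre → candidates G T pre ≡ filterᵇ (isCandidate pre) (allFin n)
  candidates≡filterᵇ pre with nth pre (a (length pre))
  ... | just c  = filterᵇ-filterᵇ (λ y → not (elemᵇ y pre)) (adj G c) (allFin n)
  ... | nothing = ≡.sym (filterᵇ-false (allFin n))

  -- stepWeight pre w is Pr(φ_j = w | φ^{j-1} = pre) for j = length pre, and pathWeight pre e is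
  -- the probability that the process continues from pre with the vertices of e.
  stepWeight : Seq → Fin n → ℚ
  stepWeight pre w = if isCandidate pre w then inv (length (candidates G T pre)) else 0ℚ

  stepWeight-at : ∀ pre w {c} → nth pre (a (length pre)) ≡ just c →
    stepWeight pre w ≡ (if adj G c w ∧ not (elemᵇ w pre) then inv (length (neighbours G c ∖ pre)) else 0ℚ)
  stepWeight-at pre w eq rewrite candidates-at pre eq | eq = refl

  stepWeight-fresh : ∀ pre {c w} → nth pre (a (length pre)) ≡ just c → adj G c w ≡ true → elemᵇ w pre ≡ false →
                     stepWeight pre w ≡ inv (length (neighbours G c ∖ pre))
  stepWeight-fresh pre {w = w} eq c~w w∉pre =
    trans (stepWeight-at pre w eq) (if-true _ (cong₂ (λ b e → b ∧ not e) c~w w∉pre))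

  stepWeight-nonadjacent : ∀ pre {c w} → nth pre (a (length pre)) ≡ just c → adj G c w ≡ false →
                           stepWeight pre w ≡ 0ℚ
  stepWeight-nonadjacent pre {w = w} eq c≁w rewrite stepWeight-at pre w eq | c≁w = refl

  stepWeight≢0-fresh : ∀ pre {c w} → nth pre (a (length pre)) ≡ just c → stepWeight pre w ≢ 0ℚ →
                       adj G c w ≡ true × elemᵇ w pre ≡ false
  stepWeight≢0-fresh pre {w = w} eq ≢0 =
    ∧-not-true (if-≢0 _ _ (≢0 ∘ trans (stepWeight-at pre w eq)))

  stepWeight≢0⇒isCandidate : ∀ pre w → stepWeight pre w ≢ 0ℚ → isCandidate pre w ≡ true
  stepWeight≢0⇒isCandidate pre w = if-≢0 (isCandidate pre w) _

  pathWeight : Seq → Seq → ℚ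
  pathWeight pre []      = 1ℚ
  pathWeight pre (w ∷ e) = stepWeight pre w ℚ.* pathWeight (pre ++ [ w ]) e

  pathWeight-++ : ∀ pre e₁ e₂ → pathWeight pre (e₁ ++ e₂) ≡ pathWeight pre e₁ ℚ.* pathWeight (pre ++ e₁) e₂
  pathWeight-++ pre []       e₂ = trans (cong (λ γ → pathWeight γ e₂) (≡.sym (LP.++-identityʳ pre)))
                                        (≡.sym (ℚP.*-identityˡ _))
  pathWeight-++ pre (w ∷ e₁) e₂ = begin
    stepWeight pre w ℚ.* pathWeight (pre ++ [ w ]) (e₁ ++ e₂)
      ≡⟨ cong (stepWeight pre w ℚ.*_) (pathWeight-++ (pre ++ [ w ]) e₁ e₂) ⟩
    stepWeight pre w ℚ.* (pathWeight (pre ++ [ w ]) e₁ ℚ.* pathWeight ((pre ++ [ w ]) ++ e₁) e₂)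
      ≡⟨ ℚP.*-assoc (stepWeight pre w) _ _ ⟨
    pathWeight pre (w ∷ e₁) ℚ.* pathWeight ((pre ++ [ w ]) ++ e₁) e₂
      ≡⟨ cong (λ γ → pathWeight pre (w ∷ e₁) ℚ.* pathWeight γ e₂) (LP.++-assoc pre [ w ] e₁) ⟩
    pathWeight pre (w ∷ e₁) ℚ.* pathWeight (pre ++ w ∷ e₁) e₂ ∎
    where open ≡-Reasoning

  extend≡sumSeq : ∀ P r pre → extend G T P r pre ≡ sumSeq r (λ e → pathWeight pre e ℚ.* 𝟙 (P (pre ++ e)))
  extend≡sumSeq P zero    pre = ≡.sym (trans (ℚP.*-identityˡ _) (cong (𝟙 ∘ P) (LP.++-identityʳ pre)))
  extend≡sumSeq P (suc r) pre = begin
    inv ∣C∣ ℚ.* sumℚ (map (λ w → extend G T P r (pre ++ [ w ])) C)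
      ≡⟨ cong (inv ∣C∣ ℚ.*_) (sumℚ-cong C (λ w → extend≡sumSeq P r (pre ++ [ w ]))) ⟩
    inv ∣C∣ ℚ.* sumℚ (map X C)
      ≡⟨ *-sumℚ (inv ∣C∣) X C ⟩
    sumℚ (map (λ w → inv ∣C∣ ℚ.* X w) C)
      ≡⟨ cong (λ ws → sumℚ (map (λ w → inv ∣C∣ ℚ.* X w) ws)) (candidates≡filterᵇ pre) ⟩
    sumℚ (map (λ w → inv ∣C∣ ℚ.* X w) (filterᵇ (isCandidate pre) (allFin n)))
      ≡⟨ sumℚ-filterᵇ (isCandidate pre) _ (allFin n) ⟩
    ∑ (λ w → if isCandidate pre w then inv ∣C∣ ℚ.* X w else 0ℚ)
      ≡⟨ sumℚ-cong (allFin n) (λ w → ≡.sym (if-* (isCandidate pre w) (inv ∣C∣) (X w))) ⟩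
    ∑ (λ w → stepWeight pre w ℚ.* X w)
      ≡⟨ sumℚ-cong (allFin n) (λ w → trans (*-sumSeq r (stepWeight pre w) _)
                                           (sumSeq-cong r (λ e _ → reassociate w e))) ⟩
    ∑ (λ w → sumSeq r (λ e → pathWeight pre (w ∷ e) ℚ.* 𝟙 (P (pre ++ w ∷ e)))) ∎
    where
    open ≡-Reasoning
    C = candidates G T pre
    ∣C∣ = length C
    X : Fin n → ℚ
    X w = sumSeq r (λ e → pathWeight (pre ++ [ w ]) e ℚ.* 𝟙 (P ((pre ++ [ w ]) ++ e)))
    reassociate : ∀ w e → stepWeight pre w ℚ.* (pathWeight (pre ++ [ w ]) e ℚ.* 𝟙 (P ((pre ++ [ w ]) ++ e)))
                          ≡ pathWeight pre (w ∷ e) ℚ.* 𝟙 (P (pre ++ w ∷ e))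
    reassociate w e = trans (≡.sym (ℚP.*-assoc (stepWeight pre w) _ _))
                            (cong (λ γ → pathWeight pre (w ∷ e) ℚ.* 𝟙 (P γ)) (LP.++-assoc pre [ w ] e))

  isMon-∷ʳ : ∀ k pre {w} → length pre ≡ suc k → suc k ≤ t → isMon G T k pre ≡ true →
             isCandidate pre w ≡ true → isMon G T (suc k) (pre ++ [ w ]) ≡ true
  isMon-∷ʳ k pre {w} ∣pre∣≡ 1+k≤t mon cand with c , pre[a∣pre∣]≡c , c~w , w∉pre ← isCandidate⁻ pre w cand =
    cong₂ _∧_ length-ok (cong₂ _∧_ distinct-ok (all-range1⁺ _ (suc k) edge-ok))
    where
    length-ok : (length (pre ++ [ w ]) ≡ᵇ suc (suc k)) ≡ true
    length-ok = T⇒≡true (ℕP.≡⇒≡ᵇ _ _ (trans (length-∷ʳ pre w) (cong suc ∣pre∣≡)))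
    distinct-ok : distinct (pre ++ [ w ]) ≡ true
    distinct-ok =
      distinct-∷ʳ pre w (BP.∧-conicalˡ (distinct pre) _ (BP.∧-conicalʳ (length pre ≡ᵇ suc k) _ mon)) w∉pre
    edge-ok : ∀ j → 1 ≤ j → j ≤ suc k → adjAt G T (pre ++ [ w ]) (a j) j ≡ true
    edge-ok j 1≤j j≤1+k with ℕP.m≤n⇒m<n∨m≡n j≤1+k
    ... | inj₁ (s≤s j≤k) =
      trans (adjAt-++ˡ pre [ w ] (ℕP.<-trans (parent-< T j 1≤j (ℕP.≤-trans j≤k (ℕP.<⇒≤ 1+k≤t))) j<∣pre∣) j<∣pre∣)
            (all-range1⁻ (λ j → adjAt G T pre (a j) j) k
              (BP.∧-conicalʳ (distinct pre) _ (BP.∧-conicalʳ (length pre ≡ᵇ suc k) _ mon)) j 1≤j j≤k)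
      where j<∣pre∣ = subst (j <_) (≡.sym ∣pre∣≡) (s≤s j≤k)
    ... | inj₂ refl = trans (adjAt-just (pre ++ [ w ]) (a (suc k)) (suc k) parent≡c last≡w) c~w
      where
      parent≡c : nth (pre ++ [ w ]) (a (suc k)) ≡ just c
      parent≡c =
        trans (nth-++ˡ pre [ w ] (subst (a (suc k) <_) (≡.sym ∣pre∣≡) (parent-< T (suc k) (s≤s z≤n) 1+k≤t)))
              (subst (λ l → nth pre (a l) ≡ just c) ∣pre∣≡ pre[a∣pre∣]≡c)
      last≡w : nth (pre ++ [ w ]) (suc k) ≡ just w
      last≡w = subst (λ l → nth (pre ++ [ w ]) l ≡ just w) ∣pre∣≡ (nth-++-length pre w [])

  pathWeight≢0⇒isMon : ∀ e pre k → length pre ≡ suc k → k ℕ.+ length e ≤ t → isMon G T k pre ≡ true →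
                       pathWeight pre e ≢ 0ℚ → isMon G T (k ℕ.+ length e) (pre ++ e) ≡ true
  pathWeight≢0⇒isMon [] pre k _ _ mon _ rewrite ℕP.+-identityʳ k | LP.++-identityʳ pre = mon
  pathWeight≢0⇒isMon (w ∷ e) pre k ∣pre∣≡ k+∣e∣<t mon ≢0 =
    subst₂ (λ l γ → isMon G T l γ ≡ true) (≡.sym (ℕP.+-suc k (length e))) (LP.++-assoc pre [ w ] e)
      (pathWeight≢0⇒isMon e (pre ++ [ w ]) (suc k) (trans (length-∷ʳ pre w) (cong suc ∣pre∣≡)) 1+k+∣e∣≤t
        (isMon-∷ʳ k pre ∣pre∣≡ 1+k≤t mon (stepWeight≢0⇒isCandidate pre w (*-≢0ˡ _ _ ≢0)))
        (*-≢0ʳ (stepWeight pre w) _ ≢0))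
    where
    1+k≤t = proj₁ (+-suc-≤ k+∣e∣<t)
    1+k+∣e∣≤t = proj₂ (+-suc-≤ k+∣e∣<t)

  neighbours-unique : ∀ c → Unique (neighbours G c)
  neighbours-unique c = UniqueP.filter⁺ (T? ∘ adj G c) (UniqueP.allFin⁺ n)

  module _ (t<deg : ∀ v → t < deg G v) where

    candidates-nonempty : ∀ pre k → length pre ≡ suc k → suc k ≤ t → 1 ≤ length (candidates G T pre)
    candidates-nonempty pre k ∣pre∣≡ 1+k≤t
      with c , pre[a∣pre∣]≡c ← nth-defined pre (subst (λ l → a l < l) (≡.sym ∣pre∣≡)
                                                     (parent-< T (suc k) (s≤s z≤n) 1+k≤t))
      rewrite candidates-at pre pre[a∣pre∣]≡c =
      ℕP.+-cancelʳ-≤ (length pre) 1 _ (begin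
        1 ℕ.+ length pre                           ≡⟨ cong suc ∣pre∣≡ ⟩
        suc (suc k)                                ≤⟨ ℕP.≤-trans (s≤s 1+k≤t) (t<deg c) ⟩
        deg G c                                    ≤⟨ length-∖ pre (neighbours G c) (neighbours-unique c) ⟩
        length (neighbours G c ∖ pre) ℕ.+ length pre ∎)
      where open ℕP.≤-Reasoning

    sumSeq-pathWeight≡1 : ∀ r pre k → length pre ≡ suc k → k ℕ.+ r ≤ t → isMon G T k pre ≡ true →
                          sumSeq r (pathWeight pre) ≡ 1ℚ
    sumSeq-pathWeight≡1 zero    pre k _ _ _ = refl
    sumSeq-pathWeight≡1 (suc r) pre k ∣pre∣≡ k+1+r≤t mon = begin
      ∑ (λ w → sumSeq r (λ e → stepWeight pre w ℚ.* pathWeight (pre ++ [ w ]) e))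
        ≡⟨ sumℚ-cong (allFin n) (λ w → trans (≡.sym (*-sumSeq r (stepWeight pre w) _)) (step w)) ⟩
      ∑ (λ w → if isCandidate pre w then K else 0ℚ)
        ≡⟨ sumℚ-if-const (isCandidate pre) K (allFin n) ⟩
      fromℕ (length (filterᵇ (isCandidate pre) (allFin n))) ℚ.* K
        ≡⟨ cong (λ ws → fromℕ (length ws) ℚ.* K) (candidates≡filterᵇ pre) ⟨
      fromℕ (length (candidates G T pre)) ℚ.* K
        ≡⟨ fromℕ*inv≡1 (candidates-nonempty pre k ∣pre∣≡ 1+k≤t) ⟩
      1ℚ ∎
      where
      open ≡-Reasoning
      K = inv (length (candidates G T pre))
      1+k≤t = proj₁ (+-suc-≤ k+1+r≤t)
      step : ∀ w → stepWeight pre w ℚ.* sumSeq r (pathWeight (pre ++ [ w ])) ≡ (if isCandidate pre w then K else 0ℚ)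
      step w with isCandidate pre w in cand
      ... | true  = trans (cong (K ℚ.*_) (sumSeq-pathWeight≡1 r (pre ++ [ w ]) (suc k)
                                           (trans (length-∷ʳ pre w) (cong suc ∣pre∣≡)) (proj₂ (+-suc-≤ k+1+r≤t))
                                           (isMon-∷ʳ k pre ∣pre∣≡ 1+k≤t mon cand)))
                          (ℚP.*-identityʳ K)
      ... | false = ℚP.*-zeroˡ (sumSeq r (pathWeight (pre ++ [ w ])))

    sumSeq-pathWeight-𝟙-const : ∀ r pre k (P : Seq → Bool) b → length pre ≡ suc k → k ℕ.+ r ≤ t →
      isMon G T k pre ≡ true → (∀ e → length e ≡ r → isMon G T (k ℕ.+ r) (pre ++ e) ≡ true → P (pre ++ e) ≡ b) →
      sumSeq r (λ e → pathWeight pre e ℚ.* 𝟙 (P (pre ++ e))) ≡ 𝟙 b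
    sumSeq-pathWeight-𝟙-const r pre k P b ∣pre∣≡ k+r≤t mon P≡b = begin
      sumSeq r (λ e → pathWeight pre e ℚ.* 𝟙 (P (pre ++ e)))
        ≡⟨ sumSeq-cong r (λ e ∣e∣≡r → trans (*-cong-≢0ˡ (pathWeight pre e) (cong 𝟙 ∘ P≡b e ∣e∣≡r ∘ mon⁺ e ∣e∣≡r))
                                             (ℚP.*-comm (pathWeight pre e) (𝟙 b))) ⟩
      sumSeq r (λ e → 𝟙 b ℚ.* pathWeight pre e)
        ≡⟨ *-sumSeq r (𝟙 b) (pathWeight pre) ⟨
      𝟙 b ℚ.* sumSeq r (pathWeight pre)
        ≡⟨ cong (𝟙 b ℚ.*_) (sumSeq-pathWeight≡1 r pre k ∣pre∣≡ k+r≤t mon) ⟩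
      𝟙 b ℚ.* 1ℚ
        ≡⟨ ℚP.*-identityʳ (𝟙 b) ⟩
      𝟙 b ∎
      where
      open ≡-Reasoning
      mon⁺ : ∀ e → length e ≡ r → pathWeight pre e ≢ 0ℚ → isMon G T (k ℕ.+ r) (pre ++ e) ≡ true
      mon⁺ e refl = pathWeight≢0⇒isMon e pre k ∣pre∣≡ k+r≤t mon

    extend-marginal : ∀ (P Q : Seq → Bool) m r x → m ℕ.+ r ≤ t →
      (∀ γ e → length γ ≡ suc m → length e ≡ r → isMon G T (m ℕ.+ r) (γ ++ e) ≡ true → P (γ ++ e) ≡ Q γ) →
      extend G T P (m ℕ.+ r) [ x ] ≡ sumSeq m (λ e → pathWeight [ x ] e ℚ.* 𝟙 (Q (x ∷ e)))
    extend-marginal P Q m r x m+r≤t P≡Q = begin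
      extend G T P (m ℕ.+ r) [ x ]
        ≡⟨ extend≡sumSeq P (m ℕ.+ r) [ x ] ⟩
      sumSeq (m ℕ.+ r) (λ e → pathWeight [ x ] e ℚ.* 𝟙 (P (x ∷ e)))
        ≡⟨ sumSeq-+-length m r _ ⟩
      sumSeq m (λ e₁ → sumSeq r (λ e₂ → pathWeight [ x ] (e₁ ++ e₂) ℚ.* 𝟙 (P (x ∷ e₁ ++ e₂))))
        ≡⟨ sumSeq-cong m marginal ⟩
      sumSeq m (λ e → pathWeight [ x ] e ℚ.* 𝟙 (Q (x ∷ e))) ∎
      where
      open ≡-Reasoning
      marginal : ∀ e₁ → length e₁ ≡ m →
        sumSeq r (λ e₂ → pathWeight [ x ] (e₁ ++ e₂) ℚ.* 𝟙 (P (x ∷ e₁ ++ e₂))) ≡ pathWeight [ x ] e₁ ℚ.* 𝟙 (Q (x ∷ e₁))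
      marginal e₁ refl = begin
        sumSeq r (λ e₂ → pathWeight [ x ] (e₁ ++ e₂) ℚ.* 𝟙 (P (x ∷ e₁ ++ e₂)))
          ≡⟨ sumSeq-cong r (λ e₂ _ → trans (cong (ℚ._* 𝟙 (P (x ∷ e₁ ++ e₂))) (pathWeight-++ [ x ] e₁ e₂))
                                           (ℚP.*-assoc (pathWeight [ x ] e₁) _ _)) ⟩
        sumSeq r (λ e₂ → pathWeight [ x ] e₁ ℚ.* (pathWeight (x ∷ e₁) e₂ ℚ.* 𝟙 (P (x ∷ e₁ ++ e₂))))
          ≡⟨ *-sumSeq r (pathWeight [ x ] e₁) _ ⟨
        pathWeight [ x ] e₁ ℚ.* sumSeq r (λ e₂ → pathWeight (x ∷ e₁) e₂ ℚ.* 𝟙 (P (x ∷ e₁ ++ e₂)))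
          ≡⟨ *-cong-≢0ˡ (pathWeight [ x ] e₁) (λ ≢0 →
               sumSeq-pathWeight-𝟙-const r (x ∷ e₁) (length e₁) P (Q (x ∷ e₁)) refl m+r≤t
                 (pathWeight≢0⇒isMon e₁ [ x ] 0 refl (ℕP.m+n≤o⇒m≤o _ m+r≤t) refl ≢0)
                 (λ e₂ → P≡Q (x ∷ e₁) e₂ refl)) ⟩
        pathWeight [ x ] e₁ ℚ.* 𝟙 (Q (x ∷ e₁)) ∎

  adj⇒≢ : ∀ {u v} → adj G u v ≡ true → u ≢ v
  adj⇒≢ {u} u~v refl = true≢false (trans (≡.sym u~v) (irrefl G u))

  startWeight : Fin n → ℚ
  startWeight x = fromℕ (deg G x) ℚ.* inv (twiceEdges G)

  extend-split : ∀ (P Q : Seq → Bool) r pre →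
    extend G T P r pre ≡ extend G T (λ γ → P γ ∧ Q γ) r pre ℚ.+ extend G T (λ γ → P γ ∧ not (Q γ)) r pre
  extend-split P Q zero    pre = 𝟙-split (P pre) (Q pre)
  extend-split P Q (suc r) pre =
    trans (cong (inv (length C) ℚ.*_) (trans (sumℚ-cong C (λ w → extend-split P Q r (pre ++ [ w ]))) (sumℚ-+ _ _ C)))
          (ℚP.*-distribˡ-+ (inv (length C)) _ _)
    where C = candidates G T pre

  Pr-split : ∀ i (P Q : Seq → Bool) → Pr G T i P ≡ Pr G T i (λ γ → P γ ∧ Q γ) ℚ.+ Pr G T i (λ γ → P γ ∧ not (Q γ))
  Pr-split i P Q = trans (sumℚ-cong (allFin n) (λ x → trans (cong (startWeight x ℚ.*_) (extend-split P Q i [ x ]))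
                                                            (ℚP.*-distribˡ-+ (startWeight x) _ _)))
                         (sumℚ-+ _ _ (allFin n))

  nth-root : 1 ≤ t → ∀ (x : Fin n) → nth [ x ] (a 1) ≡ just x
  nth-root 1≤t x = cong (nth [ x ]) (ℕP.n<1⇒n≡0 (parent-< T 1 ℕP.≤-refl 1≤t))

  startWeight*stepWeight : 1 ≤ t → ∀ x z → 1 ≤ deg G x →
                           startWeight x ℚ.* stepWeight [ x ] z ≡ (if adj G x z then inv (twiceEdges G) else 0ℚ)
  startWeight*stepWeight 1≤t x z 1≤deg with adj G x z in x~z
  ... | false = trans (cong (startWeight x ℚ.*_) (stepWeight-nonadjacent [ x ] (nth-root 1≤t x) x~z))
                      (ℚP.*-zeroʳ (startWeight x))
  ... | true  = begin
    startWeight x ℚ.* stepWeight [ x ] z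
      ≡⟨ cong (startWeight x ℚ.*_) (stepWeight-fresh [ x ] (nth-root 1≤t x) x~z (∉ᵇ-∷⁺ z x [] z≢x refl)) ⟩
    startWeight x ℚ.* inv (length (neighbours G x ∖ [ x ]))
      ≡⟨ cong (λ l → startWeight x ℚ.* inv l) ∣N∖x∣≡deg ⟩
    startWeight x ℚ.* inv (deg G x)
      ≡⟨ fromℕ*-*inv (inv (twiceEdges G)) 1≤deg ⟩
    inv (twiceEdges G) ∎
    where
    open ≡-Reasoning
    z≢x : z ≢ x
    z≢x = adj⇒≢ x~z ∘ ≡.sym
    x∉N[x] : x ∉ neighbours G x
    x∉N[x] x∈ = true≢false (trans (≡.sym (T⇒≡true (proj₂ (MP.∈-filter⁻ (T? ∘ adj G x) {xs = allFin n} x∈))))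
                                  (irrefl G x))
    ∣N∖x∣≡deg : length (neighbours G x ∖ [ x ]) ≡ deg G x
    ∣N∖x∣≡deg = trans (length-∖-∷-∉ [] (neighbours G x) x∉N[x]) (cong length (filterᵇ-true (neighbours G x)))

  adj⇒∈neighbours : ∀ {c x} → adj G c x ≡ true → x ∈ neighbours G c
  adj⇒∈neighbours {c} {x} c~x = MP.∈-filter⁺ (T? ∘ adj G c) (MP.∈-allFin x) (subst Data.Bool.T (≡.sym c~x) _)

  stepWeight-swap : ∀ {x y q c w w′} →
    nth (x ∷ q) (a (suc (length q))) ≡ just c → nth (y ∷ q) (a (suc (length q))) ≡ just c →
    adj G c x ≡ true → adj G c y ≡ true → elemᵇ x q ≡ false → elemᵇ y q ≡ false →
    adj G c w ≡ true → elemᵇ w (x ∷ q) ≡ false → adj G c w′ ≡ true → elemᵇ w′ (y ∷ q) ≡ false →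
    stepWeight (x ∷ q) w ≡ stepWeight (y ∷ q) w′
  stepWeight-swap {x} {y} {q} {c} parentˣ parentʸ c~x c~y x∉q y∉q c~w w∉ c~w′ w′∉ = begin
    stepWeight (x ∷ q) _                     ≡⟨ stepWeight-fresh (x ∷ q) parentˣ c~w w∉ ⟩
    inv (length (neighbours G c ∖ (x ∷ q)))  ≡⟨ cong inv (length-∖-∷-swap q (neighbours G c) (neighbours-unique c)
                                                  (adj⇒∈neighbours c~x) (adj⇒∈neighbours c~y) x∉q y∉q) ⟩
    inv (length (neighbours G c ∖ (y ∷ q)))  ≡⟨ stepWeight-fresh (y ∷ q) parentʸ c~w′ w′∉ ⟨
    stepWeight (y ∷ q) _                     ∎
    where open ≡-Reasoning

  -- In x ∷ mid, position a j ≥ 1 is index a j ∸ 1 of mid.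
  CommonParents : Fin n → Fin n → Seq → Set
  CommonParents x y mid = ∀ j → 2 ≤ j → j ≤ suc (length mid) → ∀ {c} → nth mid (a j ∸ 1) ≡ just c →
                          adj G c x ≡ true × adj G c y ≡ true

  module _ {x y : Fin n} {mid : Seq} (1+∣mid∣≤t : suc (length mid) ≤ t) (common : CommonParents x y mid) where

    commonParent : ∀ q {ext} → q ++ ext ≡ mid → 1 ≤ length q →
      Σ[ c ∈ Fin n ] (∀ z → nth (z ∷ q) (a (suc (length q))) ≡ just c) × adj G c x ≡ true × adj G c y ≡ true
    commonParent q {ext} q++ext≡mid 1≤∣q∣ =
      c , (λ z → trans (nth-∷ z q 1≤p) q[p-1]≡c) ,
      common j (s≤s 1≤∣q∣) j≤1+∣mid∣ (trans (cong (λ l → nth l (p ∸ 1)) (≡.sym q++ext≡mid))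
                                           (trans (nth-++ˡ q ext p-1<∣q∣) q[p-1]≡c))
      where
      j = suc (length q)
      p = a j
      j≤1+∣mid∣ : j ≤ suc (length mid)
      j≤1+∣mid∣ = s≤s (subst (length q ≤_) (trans (≡.sym (LP.length-++ q)) (cong length q++ext≡mid)) (ℕP.m≤m+n _ _))
      j≤t = ℕP.≤-trans j≤1+∣mid∣ 1+∣mid∣≤t
      1≤p : 1 ≤ p
      1≤p = root-leaf T j (s≤s 1≤∣q∣) j≤t
      p-1<∣q∣ : p ∸ 1 < length q
      p-1<∣q∣ = ∸1<-≤ 1≤p (ℕP.≤-pred (parent-< T j (s≤s z≤n) j≤t))
      c = proj₁ (nth-defined q p-1<∣q∣)
      q[p-1]≡c = proj₂ (nth-defined q p-1<∣q∣)

    -- A nonzero weight forces y ∉ q, which the induction needs to tell y from the later vertices.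
    pathWeight-swap-ends : ∀ ext q → q ++ ext ≡ mid → 1 ≤ length q → elemᵇ x q ≡ false →
      pathWeight (x ∷ q) (ext ++ [ y ]) ≢ 0ℚ →
      elemᵇ y q ≡ false × pathWeight (x ∷ q) (ext ++ [ y ]) ≡ pathWeight (y ∷ q) (ext ++ [ x ])
    pathWeight-swap-ends [] q q≡mid 1≤∣q∣ x∉q ≢0
      with c , parent≡c , c~x , c~y ← commonParent q q≡mid 1≤∣q∣
      with y≢x , y∉q ← ∉ᵇ-∷⁻ y x q (proj₂ (stepWeight≢0-fresh (x ∷ q) (parent≡c x)
                                                               (*-≢0ˡ (stepWeight (x ∷ q) y) 1ℚ ≢0))) =
      y∉q , cong (ℚ._* 1ℚ) (stepWeight-swap (parent≡c x) (parent≡c y) c~x c~y x∉q y∉q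
                                            c~y (∉ᵇ-∷⁺ y x q y≢x y∉q) c~x (∉ᵇ-∷⁺ x y q (y≢x ∘ ≡.sym) x∉q))
    pathWeight-swap-ends (w ∷ e) q q≡mid 1≤∣q∣ x∉q ≢0
      with c , parent≡c , c~x , c~y ← commonParent q q≡mid 1≤∣q∣
      with c~w , w∉x∷q ← stepWeight≢0-fresh (x ∷ q) (parent≡c x) (*-≢0ˡ (stepWeight (x ∷ q) w) _ ≢0)
      with w≢x , w∉q ← ∉ᵇ-∷⁻ w x q w∉x∷q
      with y∉q∷ʳw , rest ← pathWeight-swap-ends e (q ++ [ w ]) (trans (LP.++-assoc q [ w ] e) q≡mid)
                             (subst (1 ≤_) (≡.sym (length-∷ʳ q w)) (s≤s z≤n))
                             (∉ᵇ-++⁺ x q [ w ] x∉q (∉ᵇ-∷⁺ x w [] (w≢x ∘ ≡.sym) refl))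
                             (*-≢0ʳ (stepWeight (x ∷ q) w) _ ≢0)
      with y∉q , y∉[w] ← ∉ᵇ-++⁻ y q [ w ] y∉q∷ʳw =
      y∉q , cong₂ ℚ._*_ (stepWeight-swap (parent≡c x) (parent≡c y) c~x c~y x∉q y∉q
                                         c~w w∉x∷q c~w (∉ᵇ-∷⁺ w y q (proj₁ (∉ᵇ-∷⁻ y w [] y∉[w]) ∘ ≡.sym) w∉q)) rest

  pathWeight-swap-ends-≡ : ∀ {x y mid} → suc (length mid) ≤ t → CommonParents x y mid →
    ∀ q ext → q ++ ext ≡ mid → 1 ≤ length q → elemᵇ x q ≡ false → elemᵇ y q ≡ false →
    pathWeight (x ∷ q) (ext ++ [ y ]) ≡ pathWeight (y ∷ q) (ext ++ [ x ])
  pathWeight-swap-ends-≡ {x} {y} 1+∣mid∣≤t common q ext q≡mid 1≤∣q∣ x∉q y∉q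
    with pathWeight (x ∷ q) (ext ++ [ y ]) ℚ.≟ 0ℚ | pathWeight (y ∷ q) (ext ++ [ x ]) ℚ.≟ 0ℚ
  ... | no ≢0 | _     = proj₂ (pathWeight-swap-ends 1+∣mid∣≤t common ext q q≡mid 1≤∣q∣ x∉q ≢0)
  ... | yes _ | no ≢0 = ≡.sym (proj₂ (pathWeight-swap-ends 1+∣mid∣≤t (λ j 2≤j j≤ → swap ∘ common j 2≤j j≤)
                                                            ext q q≡mid 1≤∣q∣ y∉q ≢0))
  ... | yes ≡0 | yes ≡0′ = trans ≡0 (≡.sym ≡0′)

  isLeafIn-parent : ∀ {m j} → 1 ≤ j → j ≤ m → j ≤ t → isLeafIn G T m (a j) ≡ false
  isLeafIn-parent {m} {j} 1≤j j≤m j≤t with isLeafIn G T m (a j) in leaf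
  ... | false = refl
  ... | true  = ⊥-elim (true≢false (begin
    true                                          ≡⟨ all-range1⁻ _ m leaf j 1≤j j≤m ⟨
    not ((a j <ᵇ j) ∧ (a j ≡ᵇ a j))               ≡⟨ cong₂ (λ b b′ → not (b ∧ b′)) (T⇒≡true (ℕP.<⇒<ᵇ (parent-< T j 1≤j j≤t)))
                                                                                 (T⇒≡true (ℕP.≡⇒≡ᵇ (a j) (a j) refl)) ⟩
    false                                         ∎))
    where open ≡-Reasoning

module CompleteSymmetry {n : ℕ} (G : SimpleGraph n) {t : ℕ} (T : BFSTree t)
                        (t<deg : ∀ v → t < deg G v) (i : ℕ) (i<t : i < t) where
  open Sequences n
  open Process G T

  m : ℕ
  m = a (suc i)

  m≤i : m ≤ i
  m≤i = ℕP.≤-pred (parent-< T (suc i) (s≤s z≤n) i<t)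

  m+[i∸m]≡i : m ℕ.+ (i ∸ m) ≡ i
  m+[i∸m]≡i = ℕP.m+[n∸m]≡n m≤i

  m≤t : m ≤ t
  m≤t = ℕP.≤-trans m≤i (ℕP.<⇒≤ i<t)

  1≤t : 1 ≤ t
  1≤t = ℕP.≤-trans (s≤s z≤n) i<t

  1≤deg : ∀ x → 1 ≤ deg G x
  1≤deg x = ℕP.≤-trans (s≤s z≤n) (t<deg x)

  isComplete-++ : ∀ γ e → length γ ≡ suc m → isComplete G T i (γ ++ e) ≡ isComplete G T i γ
  isComplete-++ γ e ∣γ∣≡ = all-range1-cong _ _ (m ∸ 1) (λ j _ j≤m-1 →
    cong (isLeafIn G T m j ∨_) (cong₂ _∧_ (adjAt-++ˡ γ e (in-γ z≤n) (in-γ (j≤m j≤m-1)))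
                                          (adjAt-++ˡ γ e (in-γ ℕP.≤-refl) (in-γ (j≤m j≤m-1)))))
    where
    in-γ : ∀ {p} → p ≤ m → p < length γ
    in-γ p≤m = subst (_ <_) (≡.sym ∣γ∣≡) (s≤s p≤m)
    j≤m : ∀ {j} → j ≤ m ∸ 1 → j ≤ m
    j≤m j≤m-1 = ℕP.≤-trans j≤m-1 (ℕP.m∸n≤m m 1)

  prefixEvent : Fin n → Fin n → Seq → Bool
  prefixEvent u v γ = eqAt G T γ 0 u ∧ eqAt G T γ m v ∧ isComplete G T i γ

  prefixEvent-++ : ∀ u v γ e → length γ ≡ suc m → prefixEvent u v (γ ++ e) ≡ prefixEvent u v γ
  prefixEvent-++ u v γ e ∣γ∣≡ =
    cong₂ _∧_ (eqAt-++ˡ γ e u (subst (0 <_) (≡.sym ∣γ∣≡) (s≤s z≤n)))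
              (cong₂ _∧_ (eqAt-++ˡ γ e v (subst (m <_) (≡.sym ∣γ∣≡) ℕP.≤-refl)) (isComplete-++ γ e ∣γ∣≡))

  isΓ∧isComplete≡prefixEvent : ∀ u v γ → isMon G T i γ ≡ true →
                               isΓ G T i u v γ ∧ isComplete G T i γ ≡ prefixEvent u v γ
  isΓ∧isComplete≡prefixEvent u v γ mon rewrite mon = BP.∧-assoc (eqAt G T γ 0 u) _ _

  completeMass : Fin n → Fin n → ℚ
  completeMass u v =
    ∑ (λ x → startWeight x ℚ.* sumSeq m (λ e → pathWeight [ x ] e ℚ.* 𝟙 (prefixEvent u v (x ∷ e))))

  Pr-complete : ∀ u v → Pr G T i (λ γ → isΓ G T i u v γ ∧ isComplete G T i γ) ≡ completeMass u v
  Pr-complete u v = sumℚ-cong (allFin n) (λ x → cong (startWeight x ℚ.*_) (begin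
    extend G T complete i [ x ]
      ≡⟨ cong (λ l → extend G T complete l [ x ]) m+[i∸m]≡i ⟨
    extend G T complete (m ℕ.+ (i ∸ m)) [ x ]
      ≡⟨ extend-marginal t<deg complete (prefixEvent u v) m (i ∸ m) x
           (subst (_≤ t) (≡.sym m+[i∸m]≡i) (ℕP.<⇒≤ i<t)) complete≡prefixEvent ⟩
    sumSeq m (λ e → pathWeight [ x ] e ℚ.* 𝟙 (prefixEvent u v (x ∷ e))) ∎))
    where
    open ≡-Reasoning
    complete = λ γ → isΓ G T i u v γ ∧ isComplete G T i γ
    complete≡prefixEvent : ∀ γ e → length γ ≡ suc m → length e ≡ i ∸ m →
      isMon G T (m ℕ.+ (i ∸ m)) (γ ++ e) ≡ true → complete (γ ++ e) ≡ prefixEvent u v γ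
    complete≡prefixEvent γ e ∣γ∣≡ _ mon =
      trans (isΓ∧isComplete≡prefixEvent u v (γ ++ e) (subst (λ l → isMon G T l (γ ++ e) ≡ true) m+[i∸m]≡i mon))
            (prefixEvent-++ u v γ e ∣γ∣≡)

  completeMass-sym-root : m ≡ 0 → ∀ u v → completeMass u v ≡ completeMass v u
  completeMass-sym-root m≡0 u v = sumℚ-cong (allFin n) (λ x → cong (startWeight x ℚ.*_) (sumSeq-cong m (λ e _ →
    cong (λ b → pathWeight [ x ] e ℚ.* 𝟙 b) (swap-endpoints (x ∷ e)))))
    where
    swap-endpoints : ∀ γ → prefixEvent u v γ ≡ prefixEvent v u γ
    swap-endpoints γ = begin
      eqAt G T γ 0 u ∧ eqAt G T γ m v ∧ C  ≡⟨ cong (λ p → eqAt G T γ 0 u ∧ eqAt G T γ p v ∧ C) m≡0 ⟩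
      eqAt G T γ 0 u ∧ eqAt G T γ 0 v ∧ C  ≡⟨ x∙yz≈y∙xz (eqAt G T γ 0 u) (eqAt G T γ 0 v) C ⟩
      eqAt G T γ 0 v ∧ eqAt G T γ 0 u ∧ C  ≡⟨ cong (λ p → eqAt G T γ 0 v ∧ eqAt G T γ p u ∧ C) m≡0 ⟨
      eqAt G T γ 0 v ∧ eqAt G T γ m u ∧ C  ∎
      where
      open ≡-Reasoning
      C = isComplete G T i γ

  module Reversal (k : ℕ) (m≡1+k : m ≡ suc k) where

    nth-last : ∀ (x : Fin n) mid y → length mid ≡ k → nth (x ∷ mid ++ [ y ]) m ≡ just y
    nth-last x mid y ∣mid∣≡k =
      trans (cong (nth (x ∷ mid ++ [ y ])) (trans m≡1+k (cong suc (≡.sym ∣mid∣≡k)))) (nth-++-length mid y [])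

    isComplete-swap : ∀ x y mid → length mid ≡ k →
                      isComplete G T i (x ∷ mid ++ [ y ]) ≡ isComplete G T i (y ∷ mid ++ [ x ])
    isComplete-swap x y mid ∣mid∣≡k = all-range1-cong _ _ (m ∸ 1) swap-term
      where
      swap-term : ∀ j → 1 ≤ j → j ≤ m ∸ 1 →
        isLeafIn G T m j ∨ (adjAt G T (x ∷ mid ++ [ y ]) 0 j ∧ adjAt G T (x ∷ mid ++ [ y ]) m j)
        ≡ isLeafIn G T m j ∨ (adjAt G T (y ∷ mid ++ [ x ]) 0 j ∧ adjAt G T (y ∷ mid ++ [ x ]) m j)
      swap-term (suc j) _ 1+j≤m-1 =
        cong (isLeafIn G T m (suc j) ∨_) (begin
          adjAt G T (x ∷ mid ++ [ y ]) 0 (suc j) ∧ adjAt G T (x ∷ mid ++ [ y ]) m (suc j)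
            ≡⟨ cong₂ _∧_ (adjAt-just (x ∷ mid ++ [ y ]) 0 (suc j) refl (γ[1+j] y))
                         (adjAt-just (x ∷ mid ++ [ y ]) m (suc j) (nth-last x mid y ∣mid∣≡k) (γ[1+j] y)) ⟩
          adj G x z ∧ adj G y z
            ≡⟨ BP.∧-comm (adj G x z) (adj G y z) ⟩
          adj G y z ∧ adj G x z
            ≡⟨ cong₂ _∧_ (adjAt-just (y ∷ mid ++ [ x ]) 0 (suc j) refl (γ[1+j] x))
                         (adjAt-just (y ∷ mid ++ [ x ]) m (suc j) (nth-last y mid x ∣mid∣≡k) (γ[1+j] x)) ⟨
          adjAt G T (y ∷ mid ++ [ x ]) 0 (suc j) ∧ adjAt G T (y ∷ mid ++ [ x ]) m (suc j) ∎)
        where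
        open ≡-Reasoning
        j<∣mid∣ : j < length mid
        j<∣mid∣ = subst (j <_) (≡.sym ∣mid∣≡k) (subst (λ l → suc j ≤ l ∸ 1) m≡1+k 1+j≤m-1)
        z = proj₁ (nth-defined mid j<∣mid∣)
        γ[1+j] : ∀ w → nth (mid ++ [ w ]) j ≡ just z
        γ[1+j] w = trans (nth-++ˡ mid [ w ] j<∣mid∣) (proj₂ (nth-defined mid j<∣mid∣))

    prefixEvent-swap : ∀ u v x y mid → length mid ≡ k →
                       prefixEvent u v (x ∷ mid ++ [ y ]) ≡ prefixEvent v u (y ∷ mid ++ [ x ])
    prefixEvent-swap u v x y mid ∣mid∣≡k = begin
      eqAt G T γ 0 u ∧ eqAt G T γ m v ∧ isComplete G T i γ
        ≡⟨ cong₂ _∧_ (eqAt-just γ 0 u refl)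
                     (cong₂ _∧_ (eqAt-just γ m v (nth-last x mid y ∣mid∣≡k)) (isComplete-swap x y mid ∣mid∣≡k)) ⟩
      does (x Fin.≟ u) ∧ does (y Fin.≟ v) ∧ isComplete G T i γ′
        ≡⟨ x∙yz≈y∙xz (does (x Fin.≟ u)) (does (y Fin.≟ v)) _ ⟩
      does (y Fin.≟ v) ∧ does (x Fin.≟ u) ∧ isComplete G T i γ′
        ≡⟨ cong₂ _∧_ (eqAt-just γ′ 0 v refl)
                     (cong (_∧ isComplete G T i γ′) (eqAt-just γ′ m u (nth-last y mid x ∣mid∣≡k))) ⟨
      eqAt G T γ′ 0 v ∧ eqAt G T γ′ m u ∧ isComplete G T i γ′ ∎
      where
      open ≡-Reasoning
      γ = x ∷ mid ++ [ y ]
      γ′ = y ∷ mid ++ [ x ]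

    complete⇒CommonParents : ∀ x y mid → length mid ≡ k → isComplete G T i (x ∷ mid ++ [ y ]) ≡ true →
                             CommonParents x y mid
    complete⇒CommonParents x y mid ∣mid∣≡k complete j 2≤j j≤1+∣mid∣ {c} mid[p-1]≡c =
      trans (SimpleGraph.sym G c x) (trans (≡.sym (adjAt-just γ 0 p refl γ[p]≡c)) (BP.∧-conicalˡ _ _ edges)) ,
      trans (SimpleGraph.sym G c y) (trans (≡.sym (adjAt-just γ m p (nth-last x mid y ∣mid∣≡k) γ[p]≡c))
                                           (BP.∧-conicalʳ _ _ edges))
      where
      γ = x ∷ mid ++ [ y ]
      p = a j
      j≤m : j ≤ m
      j≤m = subst (j ≤_) (≡.sym (trans m≡1+k (cong suc (≡.sym ∣mid∣≡k)))) j≤1+∣mid∣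
      j≤t = ℕP.≤-trans j≤m m≤t
      1≤p : 1 ≤ p
      1≤p = root-leaf T j 2≤j j≤t
      p<j : p < j
      p<j = parent-< T j (ℕP.≤-trans (s≤s z≤n) 2≤j) j≤t
      p≤m-1 : p ≤ m ∸ 1
      p≤m-1 = subst (p ≤_) (≡.sym (cong (_∸ 1) m≡1+k)) (ℕP.≤-pred (subst (p <_) m≡1+k (ℕP.<-≤-trans p<j j≤m)))
      γ[p]≡c : nth γ p ≡ just c
      γ[p]≡c = trans (nth-∷ x (mid ++ [ y ]) 1≤p)
                     (trans (nth-++ˡ mid [ y ] (∸1<-≤ 1≤p (ℕP.≤-pred (ℕP.<-≤-trans p<j j≤1+∣mid∣)))) mid[p-1]≡c)
      edges : adjAt G T γ 0 p ∧ adjAt G T γ m p ≡ true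
      edges = subst (λ b → b ∨ (adjAt G T γ 0 p ∧ adjAt G T γ m p) ≡ true)
                    (isLeafIn-parent (ℕP.≤-trans (s≤s z≤n) 2≤j) j≤m j≤t)
                    (all-range1⁻ _ (m ∸ 1) complete p 1≤p p≤m-1)

    startWeight*pathWeight-swap : ∀ x y mid → length mid ≡ k → isComplete G T i (x ∷ mid ++ [ y ]) ≡ true →
      startWeight x ℚ.* pathWeight [ x ] (mid ++ [ y ]) ≡ startWeight y ℚ.* pathWeight [ y ] (mid ++ [ x ])
    startWeight*pathWeight-swap x y [] _ _ = begin
      startWeight x ℚ.* (stepWeight [ x ] y ℚ.* 1ℚ)
        ≡⟨ ℚP.*-assoc (startWeight x) _ 1ℚ ⟨
      (startWeight x ℚ.* stepWeight [ x ] y) ℚ.* 1ℚ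
        ≡⟨ cong (ℚ._* 1ℚ) (startWeight*stepWeight 1≤t x y (1≤deg x)) ⟩
      (if adj G x y then inv (twiceEdges G) else 0ℚ) ℚ.* 1ℚ
        ≡⟨ cong (λ b → (if b then inv (twiceEdges G) else 0ℚ) ℚ.* 1ℚ) (SimpleGraph.sym G x y) ⟩
      (if adj G y x then inv (twiceEdges G) else 0ℚ) ℚ.* 1ℚ
        ≡⟨ cong (ℚ._* 1ℚ) (startWeight*stepWeight 1≤t y x (1≤deg y)) ⟨
      (startWeight y ℚ.* stepWeight [ y ] x) ℚ.* 1ℚ
        ≡⟨ ℚP.*-assoc (startWeight y) _ 1ℚ ⟩
      startWeight y ℚ.* (stepWeight [ y ] x ℚ.* 1ℚ) ∎
      where open ≡-Reasoning
    startWeight*pathWeight-swap x y (z ∷ mid) ∣z∷mid∣≡k complete = begin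
      startWeight x ℚ.* (stepWeight [ x ] z ℚ.* Rˣ)
        ≡⟨ ℚP.*-assoc (startWeight x) _ Rˣ ⟨
      (startWeight x ℚ.* stepWeight [ x ] z) ℚ.* Rˣ
        ≡⟨ cong (ℚ._* Rˣ) (trans (startWeight*stepWeight 1≤t x z (1≤deg x))
                                  (if-true _ (trans (SimpleGraph.sym G x z) z~x))) ⟩
      inv (twiceEdges G) ℚ.* Rˣ
        ≡⟨ cong (inv (twiceEdges G) ℚ.*_) (pathWeight-swap-ends-≡ m≤t′ common [ z ] mid refl (s≤s z≤n)
                                             (∉ᵇ-∷⁺ x z [] (adj⇒≢ z~x ∘ ≡.sym) refl) (∉ᵇ-∷⁺ y z [] (adj⇒≢ z~y ∘ ≡.sym) refl)) ⟩
      inv (twiceEdges G) ℚ.* Rʸ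
        ≡⟨ cong (ℚ._* Rʸ) (trans (startWeight*stepWeight 1≤t y z (1≤deg y))
                                  (if-true _ (trans (SimpleGraph.sym G y z) z~y))) ⟨
      (startWeight y ℚ.* stepWeight [ y ] z) ℚ.* Rʸ
        ≡⟨ ℚP.*-assoc (startWeight y) _ Rʸ ⟩
      startWeight y ℚ.* (stepWeight [ y ] z ℚ.* Rʸ) ∎
      where
      open ≡-Reasoning
      Rˣ = pathWeight (x ∷ [ z ]) (mid ++ [ y ])
      Rʸ = pathWeight (y ∷ [ z ]) (mid ++ [ x ])
      common = complete⇒CommonParents x y (z ∷ mid) ∣z∷mid∣≡k complete
      m≤t′ : suc (length (z ∷ mid)) ≤ t
      m≤t′ = subst (_≤ t) (trans m≡1+k (cong suc (≡.sym ∣z∷mid∣≡k))) m≤t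
      2≤t : 2 ≤ t
      2≤t = ℕP.≤-trans (s≤s (s≤s z≤n)) m≤t′
      a2≡1 : a 2 ≡ 1
      a2≡1 = ℕP.≤-antisym (ℕP.≤-pred (parent-< T 2 (s≤s z≤n) 2≤t)) (root-leaf T 2 ℕP.≤-refl 2≤t)
      z-adjacent = common 2 ℕP.≤-refl (s≤s (s≤s z≤n)) (cong (λ p → nth (z ∷ mid) (p ∸ 1)) a2≡1)
      z~x = proj₁ z-adjacent
      z~y = proj₂ z-adjacent

    summand : Fin n → Fin n → Fin n → Seq → ℚ
    summand u v x e = (startWeight x ℚ.* pathWeight [ x ] e) ℚ.* 𝟙 (prefixEvent u v (x ∷ e))

    completeMass≡ : ∀ u v → completeMass u v ≡ sumSeq k (λ mid → ∑ (λ x → ∑ (λ y → summand u v x (mid ++ [ y ]))))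
    completeMass≡ u v = begin
      ∑ (λ x → startWeight x ℚ.* sumSeq m (λ e → pathWeight [ x ] e ℚ.* 𝟙 (prefixEvent u v (x ∷ e))))
        ≡⟨ sumℚ-cong (allFin n) (λ x → trans (*-sumSeq m (startWeight x) _)
                                             (sumSeq-cong m (λ e _ → ≡.sym (ℚP.*-assoc (startWeight x) _ _)))) ⟩
      ∑ (λ x → sumSeq m (summand u v x))
        ≡⟨ cong (λ l → ∑ (λ x → sumSeq l (summand u v x))) m≡1+k ⟩
      ∑ (λ x → sumSeq (suc k) (summand u v x))
        ≡⟨ sumℚ-cong (allFin n) (λ x → sumSeq-suc-∷ʳ k (summand u v x)) ⟩
      ∑ (λ x → sumSeq k (λ mid → ∑ (λ y → summand u v x (mid ++ [ y ]))))
        ≡⟨ ∑-sumSeq-comm k _ ⟩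
      sumSeq k (λ mid → ∑ (λ x → ∑ (λ y → summand u v x (mid ++ [ y ])))) ∎
      where open ≡-Reasoning

    summand-swap : ∀ u v x y mid → length mid ≡ k → summand u v x (mid ++ [ y ]) ≡ summand v u y (mid ++ [ x ])
    summand-swap u v x y mid ∣mid∣≡k =
      trans (cong (λ b → (startWeight x ℚ.* pathWeight [ x ] (mid ++ [ y ])) ℚ.* 𝟙 b)
                  (prefixEvent-swap u v x y mid ∣mid∣≡k))
            (*𝟙-cong (prefixEvent v u γ′) (startWeight*pathWeight-swap x y mid ∣mid∣≡k ∘ complete))
      where
      γ′ = y ∷ mid ++ [ x ]
      complete : prefixEvent v u γ′ ≡ true → isComplete G T i (x ∷ mid ++ [ y ]) ≡ true
      complete event = trans (isComplete-swap x y mid ∣mid∣≡k)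
                             (BP.∧-conicalʳ (eqAt G T γ′ m u) _ (BP.∧-conicalʳ (eqAt G T γ′ 0 v) _ event))

    completeMass-swap : ∀ u v → completeMass u v ≡ completeMass v u
    completeMass-swap u v = begin
      completeMass u v
        ≡⟨ completeMass≡ u v ⟩
      sumSeq k (λ mid → ∑ (λ x → ∑ (λ y → summand u v x (mid ++ [ y ]))))
        ≡⟨ sumSeq-cong k (λ mid ∣mid∣≡k → trans (sumℚ-comm (λ x y → summand u v x (mid ++ [ y ])) (allFin n) (allFin n))
             (sumℚ-cong (allFin n) (λ y → sumℚ-cong (allFin n) (λ x → summand-swap u v x y mid ∣mid∣≡k)))) ⟩
      sumSeq k (λ mid → ∑ (λ y → ∑ (λ x → summand v u y (mid ++ [ x ]))))
        ≡⟨ completeMass≡ v u ⟨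
      completeMass v u ∎
      where open ≡-Reasoning

  completeMass-sym : ∀ u v → completeMass u v ≡ completeMass v u
  completeMass-sym = by-cases m refl
    where
    by-cases : ∀ l → m ≡ l → ∀ u v → completeMass u v ≡ completeMass v u
    by-cases zero    m≡0   = completeMass-sym-root m≡0
    by-cases (suc k) m≡1+k = Reversal.completeMass-swap k m≡1+k

  Pr-isΓ-difference≡Pr-isΓnc-difference : ∀ u v → Pr G T i (isΓ G T i v u) - Pr G T i (isΓ G T i u v)
                           ≡ Pr G T i (isΓnc G T i v u) - Pr G T i (isΓnc G T i u v)
  Pr-isΓ-difference≡Pr-isΓnc-difference u v = begin
    Pr G T i (isΓ G T i v u) - Pr G T i (isΓ G T i u v)
      ≡⟨ cong₂ _-_ (Pr-split i (isΓ G T i v u) (isComplete G T i)) (Pr-split i (isΓ G T i u v) (isComplete G T i)) ⟩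
    (Pr-c v u ℚ.+ Pr-nc v u) - (Pr-c u v ℚ.+ Pr-nc u v)
      ≡⟨ cong (λ p → (p ℚ.+ Pr-nc v u) - (Pr-c u v ℚ.+ Pr-nc u v)) complete-sym ⟩
    (Pr-c u v ℚ.+ Pr-nc v u) - (Pr-c u v ℚ.+ Pr-nc u v)
      ≡⟨ [k+p]-[k+q]≡p-q (Pr-c u v) (Pr-nc v u) (Pr-nc u v) ⟩
    Pr-nc v u - Pr-nc u v ∎
    where
    open ≡-Reasoning
    Pr-c Pr-nc : Fin n → Fin n → ℚ
    Pr-c u v = Pr G T i (λ γ → isΓ G T i u v γ ∧ isComplete G T i γ)
    Pr-nc u v = Pr G T i (isΓnc G T i u v)
    complete-sym : Pr-c v u ≡ Pr-c u v
    complete-sym = trans (Pr-complete v u) (trans (completeMass-sym v u) (≡.sym (Pr-complete u v)))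

mainTheorem6 : ∀ {n : ℕ} (G : SimpleGraph n) (t : ℕ) (T : BFSTree t) →
    1 ≤ t →
    (∀ v → twiceEdges G ≤ 4 * n * deg G v) →
    (∀ v → t < deg G v) →
    ∀ (i : ℕ) → i < t → ∀ (u v : Fin n) →
    Pr G T i (isΓ G T i v u) - Pr G T i (isΓ G T i u v)
      ≡ Pr G T i (isΓnc G T i v u) - Pr G T i (isΓnc G T i u v)
mainTheorem6 G t T _ _ t<deg i i<t = CompleteSymmetry.Pr-isΓ-difference≡Pr-isΓnc-difference G T t<deg i i<t
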